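{- Let $S=S[1..n]$ be a string and let $0\le k\le n-1$. Then: (1) $\mathrm{LSUS}_1^k$ exists. (2) If $\mathrm{LSUS}_p^k$ exists for some position $p$, then $\mathrm{LSUS}_i^k$ exists for every $1\le i\le p$. (3) If $\mathrm{LSUS}_p^k$ does not exist for some position $p$, then $\mathrm{LSUS}_i^k$ does not exist for any $i$ with $p\le i\le n$.
   Context: For $1\le i\le j\le n$, $S[i..j]=S[i]\cdots S[j]$ is a substring. $H$ denotes the Hamming distance between equal-length strings. For an integer $k\ge 0$, a substring $S[i..j]$ is $k$-mismatch unique if there is no substring $S[i'..j']$ with $i'\ne i$, $j'-i'=j-i$ and $H(S[i..j],S[i'..j'])\le k$; otherwise it is a $k$-mismatch repeat. For a position $p$ and $0\le k\le n-1$, the $k$-mismatch left-bounded shortest unique substring $\mathrm{LSUS}_p^k$ is a $k$-mismatch unique substring $S[p..j]$ such that either $j=p$ or no proper prefix $S[p..j']$ with $p\le j'<j$ is $k$-mismatch unique. In other words, it is the shortest $k$-mismatch unique substring starting at $p$. It may not exist. -}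

module Defs where

open import Data.Nat using (ℕ; zero; suc; _+_; _∸_; _≤_; _<_; _≤?_)

open import Data.Fin using (Fin; fromℕ<)
open import Data.Product using (Σ; _×_; ∃; ∃-syntax)
open import Data.Sum using (_⊎_)
open import Relation.Nullary using (¬_; yes; no)
open import Relation.Binary.Definitions using (DecidableEquality)
open import Relation.Binary.PropositionalEquality using (_≡_; _≢_)

-- A string S = S[1..n] over alphabet A is a function Fin n → A
-- (S[i] for 1-based i is S (i-1)).

-- Out of range
-- positions are given a dummy by comparing equal (see mismatch).
module _ {A : Set} (_≟_ : DecidableEquality A) {n : ℕ} (S : Fin n → A) where

  mismatch : ℕ → ℕ → ℕ
  mismatch a b with suc (a ∸ 1) ≤? n | suc (b ∸ 1) ≤? n
  ... | yes a< | yes b< with S (fromℕ< a<) ≟ S (fromℕ< b<)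
  ...   | yes _ = 0
  ...   | no  _ = 1
  mismatch a b | _ | _ = 0

  ham : ℕ → ℕ → ℕ → ℕ
  ham i i' zero    = 0
  ham i i' (suc ℓ) = mismatch (i + ℓ) (i' + ℓ) + ham i i' ℓ

  Substr : ℕ → ℕ → Set
  Substr i j = 1 ≤ i × i ≤ j × j ≤ n

  H : ℕ → ℕ → ℕ → ℕ
  H i j i' = ham i i' (suc (j ∸ i))

  KUnique : ℕ → ℕ → ℕ → Set
  KUnique k i j =
    Substr i j ×
    (∀ i' j' → Substr i' j' → i' ≢ i → j' ∸ i' ≡ j ∸ i → ¬ (H i j i' ≤ k))

  IsLSUS : ℕ → ℕ → ℕ → Set
  IsLSUS k p j =
    KUnique k p j ×
    (j ≡ p ⊎ (∀ j' → p ≤ j' → j' < j → ¬ KUnique k p j'))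

  LSUSExists : ℕ → ℕ → Set
  LSUSExists k p = ∃[ j ] IsLSUS k p j

-- The whole string S[1..n] is k-mismatch unique for every k, because no other
-- substring has its length. Extending a
-- k-mismatch unique substring to the left keeps it unique: a k-mismatch copy of
-- S[i..j] starting at i' contains, at the same offset, a k-mismatch copy of
-- S[p..j] starting at i' + (p - i). So every start i ≤ p of a unique S[p..j] begins
-- a unique substring, and as uniqueness is decidable, a least such substring exists.
module Submission where

open import Defs
open import Data.Nat using (ℕ; zero; suc; _+_; _∸_; _≤_; _<_; _≤?_; s≤s)
  renaming (_≟_ to _≟ℕ_)
open import Data.Nat.Properties
open import Data.Fin using (Fin)
open import Data.Product using (_×_; _,_; ∃-syntax)
open import Data.Sum using (inj₂)
open import Relation.Nullary using (¬_; Dec; yes; no; ¬?)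
open import Relation.Nullary.Decidable using (map′; _×-dec_; _→-dec_)
open import Relation.Binary.Definitions using (DecidableEquality)
open import Relation.Binary.PropositionalEquality
open import Function using (_∘_)

least-witness : {P : ℕ → Set} → (∀ m → Dec (P m)) →
                ∀ v → ∃[ m ] (m < v × P m) → ∃[ m ] (P m × ∀ {j} → j < m → ¬ P j)
least-witness P? (suc v) (m , s≤s m≤v , Pm) with anyUpTo? P? v
... | yes below = least-witness P? v below
... | no none   = m , Pm , λ j<m Pj → none (_ , <-≤-trans j<m m≤v , Pj)

module _ {A : Set} (_≟_ : DecidableEquality A) {n : ℕ} (S : Fin n → A) where

  ham-+ : ∀ a b d l → ham _≟_ S a b (d + l) ≡ ham _≟_ S (a + d) (b + d) l + ham _≟_ S a b d
  ham-+ a b d zero    = cong (ham _≟_ S a b) (+-identityʳ d)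
  ham-+ a b d (suc l) = begin
    ham _≟_ S a b (d + suc l)
      ≡⟨ cong (ham _≟_ S a b) (+-suc d l) ⟩
    mismatch _≟_ S (a + (d + l)) (b + (d + l)) + ham _≟_ S a b (d + l)
      ≡⟨ cong₂ (λ x y → mismatch _≟_ S x y + ham _≟_ S a b (d + l))
               (sym (+-assoc a d l)) (sym (+-assoc b d l)) ⟩
    mismatch _≟_ S (a + d + l) (b + d + l) + ham _≟_ S a b (d + l)
      ≡⟨ cong (mismatch _≟_ S (a + d + l) (b + d + l) +_) (ham-+ a b d l) ⟩
    mismatch _≟_ S (a + d + l) (b + d + l) + (ham _≟_ S (a + d) (b + d) l + ham _≟_ S a b d)
      ≡⟨ sym (+-assoc (mismatch _≟_ S (a + d + l) (b + d + l)) _ _) ⟩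
    ham _≟_ S (a + d) (b + d) (suc l) + ham _≟_ S a b d
      ∎
    where open ≡-Reasoning

  ham-dropˡ : ∀ a b d l → ham _≟_ S (a + d) (b + d) l ≤ ham _≟_ S a b (d + l)
  ham-dropˡ a b d l = ≤-trans (m≤m+n _ _) (≤-reflexive (sym (ham-+ a b d l)))

  Substr? : ∀ i j → Dec (Substr _≟_ S i j)
  Substr? i j = (1 ≤? i) ×-dec (i ≤? j) ×-dec (j ≤? n)

  NotCopy : ℕ → ℕ → ℕ → ℕ → ℕ → Set
  NotCopy k i j i' j' =
    Substr _≟_ S i' j' → i' ≢ i → j' ∸ i' ≡ j ∸ i → ¬ (H _≟_ S i j i' ≤ k)

  NotCopy? : ∀ k i j i' j' → Dec (NotCopy k i j i' j')
  NotCopy? k i j i' j' =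
    Substr? i' j' →-dec ¬? (i' ≟ℕ i) →-dec (j' ∸ i' ≟ℕ j ∸ i) →-dec ¬? (H _≟_ S i j i' ≤? k)

  KUnique? : ∀ k i j → Dec (KUnique _≟_ S k i j)
  KUnique? k i j = Substr? i j ×-dec map′ unbound bound
    (allUpTo? (λ i' → allUpTo? (NotCopy? k i j i') (suc n)) (suc n))
    where
    Bounded : Set
    Bounded = ∀ {i'} → i' < suc n → ∀ {j'} → j' < suc n → NotCopy k i j i' j'
    unbound : Bounded → ∀ i' j' → NotCopy k i j i' j'
    unbound all i' j' s@(_ , i'≤j' , j'≤n) = all (s≤s (≤-trans i'≤j' j'≤n)) (s≤s j'≤n) s
    bound : (∀ i' j' → NotCopy k i j i' j') → Bounded
    bound all {i'} _ {j'} _ = all i' j'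

  KUnique-whole : ∀ k → 1 ≤ n → KUnique _≟_ S k 1 n
  KUnique-whole k 1≤n = (≤-refl , 1≤n , ≤-refl) , λ i' j' (1≤i' , i'≤j' , j'≤n) i'≢1 len _ →
    i'≢1 (≤-antisym (+-cancelʳ-≤ (n ∸ 1) i' 1 (begin
      i' + (n ∸ 1)   ≡⟨ cong (i' +_) (sym len) ⟩
      i' + (j' ∸ i') ≡⟨ m+[n∸m]≡n i'≤j' ⟩
      j'             ≤⟨ j'≤n ⟩
      n              ≡⟨ sym (m+[n∸m]≡n 1≤n) ⟩
      1 + (n ∸ 1)    ∎)) 1≤i')
    where open ≤-Reasoning

  KUnique-extendˡ : ∀ {k i p j} → 1 ≤ i → i ≤ p → KUnique _≟_ S k p j → KUnique _≟_ S k i j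
  KUnique-extendˡ {k} {i} {p} {j} 1≤i i≤p ((_ , p≤j , j≤n) , unique)
    with m≤n⇒∃[o]m+o≡n i≤p
  ... | d , refl = (1≤i , ≤-trans i≤p p≤j , j≤n) , noCopy
    where
    d≤j∸i : d ≤ j ∸ i
    d≤j∸i = m+n≤o⇒m≤o∸n d (subst (_≤ j) (+-comm i d) p≤j)

    d+[j∸[i+d]]≡j∸i : d + (j ∸ (i + d)) ≡ j ∸ i
    d+[j∸[i+d]]≡j∸i = trans (cong (d +_) (sym (∸-+-assoc j i d))) (m+[n∸m]≡n d≤j∸i)

    noCopy : ∀ i' j' → NotCopy k i j i' j'
    noCopy i' j' (1≤i' , i'≤j' , j'≤n) i'≢i len dist =
      unique (i' + d) j' (≤-trans 1≤i' (m≤m+n i' d) , i'+d≤j' , j'≤n)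
             (i'≢i ∘ +-cancelʳ-≡ d i' i) len′ (≤-trans shifted dist)
      where
      i'+d≤j' : i' + d ≤ j'
      i'+d≤j' = ≤-trans (+-monoʳ-≤ i' (subst (d ≤_) (sym len) d≤j∸i))
                        (≤-reflexive (m+[n∸m]≡n i'≤j'))
      len′ : j' ∸ (i' + d) ≡ j ∸ (i + d)
      len′ = begin
        j' ∸ (i' + d) ≡⟨ sym (∸-+-assoc j' i' d) ⟩
        j' ∸ i' ∸ d   ≡⟨ cong (_∸ d) len ⟩
        j ∸ i ∸ d     ≡⟨ ∸-+-assoc j i d ⟩
        j ∸ (i + d)   ∎
        where open ≡-Reasoning
      shifted : H _≟_ S (i + d) j (i' + d) ≤ H _≟_ S i j i'
      shifted = ≤-trans (ham-dropˡ i i' d (suc (j ∸ (i + d))))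
        (≤-reflexive (cong (ham _≟_ S i i') (trans (+-suc d _) (cong suc d+[j∸[i+d]]≡j∸i))))

  LSUS-exists : ∀ {k p j} → KUnique _≟_ S k p j → LSUSExists _≟_ S k p
  LSUS-exists {k} {p} {j} unique with least-witness (KUnique? k p) (suc j) (j , ≤-refl , unique)
  ... | m , uniqueₘ , shorter = m , uniqueₘ , inj₂ λ _ _ j'<m → shorter j'<m

lemma1 : {A : Set} (_≟_ : DecidableEquality A) (n : ℕ) (S : Fin n → A) (k : ℕ) →
    1 ≤ n → k ≤ n ∸ 1 →
    LSUSExists _≟_ S k 1
    × (∀ p → 1 ≤ p → p ≤ n → LSUSExists _≟_ S k p →
         ∀ i → 1 ≤ i → i ≤ p → LSUSExists _≟_ S k i)
    × (∀ p → 1 ≤ p → p ≤ n → ¬ LSUSExists _≟_ S k p →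
         ∀ i → p ≤ i → i ≤ n → ¬ LSUSExists _≟_ S k i)
lemma1 _≟_ n S k 1≤n _ = LSUS-exists _≟_ S (KUnique-whole _≟_ S k 1≤n) , downward , upward
  where
  downward : ∀ p → 1 ≤ p → p ≤ n → LSUSExists _≟_ S k p →
             ∀ i → 1 ≤ i → i ≤ p → LSUSExists _≟_ S k i
  downward p _ _ (_ , unique , _) i 1≤i i≤p =
    LSUS-exists _≟_ S (KUnique-extendˡ _≟_ S 1≤i i≤p unique)

  upward : ∀ p → 1 ≤ p → p ≤ n → ¬ LSUSExists _≟_ S k p →
           ∀ i → p ≤ i → i ≤ n → ¬ LSUSExists _≟_ S k i
  upward p 1≤p _ none i p≤i i≤n lsusᵢ = none (downward i (≤-trans 1≤p p≤i) i≤n lsusᵢ p 1≤p p≤i)
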